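{- Let $n\ge1$. For every $C\in DC(n)$, $\Phi(C)$ is a Dellac history of length $2n$, i.e. $\Phi(C)\in DH(n)$.
   Context: Dellac configurations: placements of $2n$ dots in a grid with $n$ columns (indexed $1..n$ left to right) and $2n$ rows (indexed $1..2n$ bottom to top), exactly one dot per row and two per column, each dot in column $j$, row $i$ satisfying $j\le i\le j+n$; $DC(n)$ is their set. An inversion is a pair of dots with (column,row) coordinates $(j_1,i_1),(j_2,i_2)$, $j_1<j_2$, $i_1>i_2$. Write $e_i$ for the dot in row $i$; it is even if $i\le n$ and odd if $i>n$. For $i\le n$, $l^e_C(e_i)$ is the number of inversions formed by $e_i$ and a dot $e_{i'}$ with $i<i'\le n$; for $i>n$, $r^o_C(e_i)$ is the number of inversions formed by $e_i$ and a dot $e_{i'}$ with $n<i'<i$. For $j\in[n]$, $i_1(j)<i_2(j)$ are the rows of the two dots of column $j$, and $h(j)$ is the number of even dots minus the number of odd dots in the first $j-1$ columns. The map $\Phi$: $\Phi(C)=(\gamma,\xi)$ where $\gamma=(p_0,\dots,p_{2n})$, $p_0=(0,0)$, each step $(1,1)$ (up) or $(1,-1)$ (down), and $\xi=(\xi_1,\dots,\xi_n)$, are built for $j=1,\dots,n$, with $i-1$ the number of down steps among the first $2j-2$ steps: (1) if $i_2(j)\le n$: steps $(p_{2j-2},p_{2j-1}),(p_{2j-1},p_{2j})$ are both up; (2) if $i_1(j)\le n<i_2(j)$: $\xi_i=(l^e_C(e_{i_1(j)}),r^o_C(e_{i_2(j)}))$; if $l^e_C(e_{i_1(j)})>r^o_C(e_{i_2(j)})$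 the step $(p_{2j-2},p_{2j-1})$ is down and $(p_{2j-1},p_{2j})$ up, otherwise the first is up and the second down; (3) if $n<i_1(j)$: both steps are down; with $2k=h(j)$, let $j_m$ be the largest $j'<j$ with $h(j'+1)=2k$ and column $j'$ containing two even dots (such $j'$ exists); $\xi_i=(l^e_C(e_{i_1(j_m)}),l^e_C(e_{i_2(j_m)}))$, $\xi_{i+1}=(r^o_C(e_{i_1(j)}),r^o_C(e_{i_2(j)}))$. Dellac histories: a Dyck path of length $2n$ is $(p_0,\dots,p_{2n})$ in $\mathbb{N}^2$ from $(0,0)$ to $(2n,0)$ with steps $(1,\pm1)$; its down steps are $s^d_1,\dots,s^d_n$ from left to right. A Dellac history of length $2n$ is $(\gamma,\xi)$ with $\gamma$ such a Dyck path and $\xi_i=(n_1(i),n_2(i))$ pairs of nonnegative integers such that for each $j\in[n]$, with $2k$ the height of $p_{2j-2}$: (1) if $(p_{2j-2},p_{2j-1})=s^d_i$ is down and $(p_{2j-1},p_{2j})$ up, then $k\ge n_1(i)>n_2(i)\ge0$; (2) if $(p_{2j-2},p_{2j-1})$ is up and $(p_{2j-1},p_{2j})=s^d_i$ down, then $0\le n_1(i)\le n_2(i)\le k$; (3) if $(p_{2j-2},p_{2j-1})=s^d_i$ and $(p_{2j-1},p_{2j})=s^d_{i+1}$ are both down, then $k-1\ge n_1(i)\ge n_2(i)\ge0$ and $0\le n_1(i+1)\le n_2(i+1)\le k-1$. $DH(n)$ is the set of Dellac histories of length $2n$. -}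

module Defs where

open import Data.Bool using (Bool; true; false; _∧_; _∨_; if_then_else_)
open import Data.Nat using (ℕ; zero; suc; _+_; _*_; _∸_; _≤_; _<_; _≡ᵇ_; _<ᵇ_; _≤ᵇ_)
open import Data.Integer as ℤ using (ℤ; +_; _-_)
open import Data.List using (List; []; _∷_; length; map; upTo; filterᵇ; concatMap; take)
open import Data.Maybe using (Maybe; just; nothing)
open import Data.Product using (_×_; _,_; proj₁; proj₂)
open import Relation.Nullary.Decidable using (⌊_⌋)
open import Relation.Binary.PropositionalEquality using (_≡_)

-- the list [lo, lo+1, ..., hi] (empty if hi < lo)
interval : ℕ → ℕ → List ℕ
interval lo hi = map (λ x → lo + x) (upTo (suc hi ∸ lo))

count : {A : Set} → (A → Bool) → List A → ℕ
count p xs = length (filterᵇ p xs)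

at : {A : Set} → List A → ℕ → Maybe A
at []       _       = nothing
at (x ∷ _)  zero    = just x
at (_ ∷ xs) (suc m) = at xs m

atD : List ℕ → ℕ → ℕ
atD []       _       = 0
atD (x ∷ _)  zero    = x
atD (_ ∷ xs) (suc m) = atD xs m

lastD : List ℕ → ℕ
lastD []       = 0
lastD (x ∷ []) = x
lastD (_ ∷ xs) = lastD xs

-- Dellac configurations.
-- A configuration is given by C : ℕ → ℕ, C i = column of the (unique) dot
-- in row i (only rows 1..2n matter).  "One dot per row" is built in.

DC : ℕ → (ℕ → ℕ) → Set
DC n C =
  (∀ i → 1 ≤ i → i ≤ 2 * n → (1 ≤ C i) × (C i ≤ n) × (C i ≤ i) × (i ≤ C i + n))
  × (∀ j → 1 ≤ j → j ≤ n → count (λ i → C i ≡ᵇ j) (interval 1 (2 * n)) ≡ 2)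

inv : (ℕ → ℕ) → ℕ → ℕ → Bool
inv C i i' = ((C i <ᵇ C i') ∧ (i' <ᵇ i)) ∨ ((C i' <ᵇ C i) ∧ (i <ᵇ i'))

le : ℕ → (ℕ → ℕ) → ℕ → ℕ
le n C i = count (inv C i) (interval (suc i) n)

ro : ℕ → (ℕ → ℕ) → ℕ → ℕ
ro n C i = count (inv C i) (interval (suc n) (i ∸ 1))

colRows : ℕ → (ℕ → ℕ) → ℕ → List ℕ
colRows n C j = filterᵇ (λ i → C i ≡ᵇ j) (interval 1 (2 * n))

i₁ : ℕ → (ℕ → ℕ) → ℕ → ℕ
i₁ n C j = atD (colRows n C j) 0

i₂ : ℕ → (ℕ → ℕ) → ℕ → ℕ
i₂ n C j = atD (colRows n C j) 1

-- h(j): even dots minus odd dots in the columns 1..j-1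
h : ℕ → (ℕ → ℕ) → ℕ → ℤ
h n C j = + count (λ i → (C i <ᵇ j) ∧ (i ≤ᵇ n)) (interval 1 (2 * n))
        - + count (λ i → (C i <ᵇ j) ∧ (n <ᵇ i)) (interval 1 (2 * n))

-- j_m: the largest j' < j with h(j'+1) = h(j) and column j' containing two
-- even dots (0 if none; the paper guarantees existence)
jm : ℕ → (ℕ → ℕ) → ℕ → ℕ
jm n C j = lastD (filterᵇ (λ j' → ⌊ h n C (suc j') ℤ.≟ h n C j ⌋ ∧ (i₂ n C j' ≤ᵇ n))
                          (interval 1 (j ∸ 1)))

data Step : Set where
  U D : Step   -- U = (1,1), D = (1,-1)

ht : List Step → ℤ
ht []       = + 0
ht (U ∷ s) = + 1 ℤ.+ ht s
ht (D ∷ s) = ℤ.- (+ 1) ℤ.+ ht s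

downs : List Step → ℕ
downs []       = 0
downs (U ∷ s) = downs s
downs (D ∷ s) = suc (downs s)

-- Column j contributes its two steps (2j-1, 2j) to γ and its
-- ξ-entries (0, 1 or 2 of them) to ξ; since the number of ξ-entries
-- contributed equals the number of down steps contributed, the entry
-- contributed at column j lands at position i (resp. i, i+1) where i-1 is the
-- number of down steps among the first 2j-2 steps, as in the paper.

colStep : ℕ → (ℕ → ℕ) → ℕ → List Step × List (ℕ × ℕ)
colStep n C j =
  if i₂ n C j ≤ᵇ n then (U ∷ U ∷ [] , [])
  else if i₁ n C j ≤ᵇ n then
    ((if ro n C (i₂ n C j) <ᵇ le n C (i₁ n C j) then D ∷ U ∷ [] else U ∷ D ∷ [])
    , (le n C (i₁ n C j) , ro n C (i₂ n C j)) ∷ [])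
  else (D ∷ D ∷ [] ,
        (le n C (i₁ n C (jm n C j)) , le n C (i₂ n C (jm n C j)))
        ∷ (ro n C (i₁ n C j) , ro n C (i₂ n C j)) ∷ [])

Φ : ℕ → (ℕ → ℕ) → List Step × List (ℕ × ℕ)
Φ n C = concatMap (λ j → proj₁ (colStep n C j)) (interval 1 n)
      , concatMap (λ j → proj₂ (colStep n C j)) (interval 1 n)

IsDyck : ℕ → List Step → Set
IsDyck n γ = (length γ ≡ 2 * n)
           × (∀ m → m ≤ 2 * n → + 0 ℤ.≤ ht (take m γ))
           × (ht γ ≡ + 0)

-- ξ_i (1-based)
ξat : List (ℕ × ℕ) → ℕ → Maybe (ℕ × ℕ)
ξat ξ i = at ξ (i ∸ 1)

-- conditions for column j; the steps (p_{2j-2},p_{2j-1}), (p_{2j-1},p_{2j})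
-- are at 0-based positions 2j-2, 2j-1 of γ; i-1 = number of down steps among
-- the first 2j-2 steps, so the first (resp. second) down step in this pair is s^d_i.
DHcond : ℕ → List Step → List (ℕ × ℕ) → ℕ → Set
DHcond n γ ξ j =
  ∀ k → ht (take (2 * (j ∸ 1)) γ) ≡ + (2 * k) →
    ((at γ (2 * (j ∸ 1)) ≡ just D → at γ (suc (2 * (j ∸ 1))) ≡ just U →
        ∀ a b → ξat ξ i ≡ just (a , b) → (a ≤ k) × (b < a))
    × (at γ (2 * (j ∸ 1)) ≡ just U → at γ (suc (2 * (j ∸ 1))) ≡ just D →
        ∀ a b → ξat ξ i ≡ just (a , b) → (a ≤ b) × (b ≤ k))
    × (at γ (2 * (j ∸ 1)) ≡ just D → at γ (suc (2 * (j ∸ 1))) ≡ just D →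
        ∀ a b c d → ξat ξ i ≡ just (a , b) → ξat ξ (suc i) ≡ just (c , d) →
        (a + 1 ≤ k) × (b ≤ a) × (c ≤ d) × (d + 1 ≤ k)))
  where
    i : ℕ
    i = suc (downs (take (2 * (j ∸ 1)) γ))

DH : ℕ → List Step × List (ℕ × ℕ) → Set
DH n (γ , ξ) = IsDyck n γ × (length ξ ≡ n)
             × (∀ j → 1 ≤ j → j ≤ n → DHcond n γ ξ j)

module Submission where

-- A Dellac history is read column by column: column j contributes two steps of the path and one
-- ξ-entry per down step, and the defining conditions only compare these with the height 2k of
-- the path before the column.
--
-- For a configuration C (module Configuration) the half-height before column j is A j, the
-- number of even dots of rows j..n lying in columns < j.  Counting dots shows that A j equals
-- B j, the number of odd dots of rows n+1..n+j-1 lying in columns ≥ j, and that h(j) = 2 A j;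
-- the inversion numbers l^e and r^o are bounded by A and B; and A rises by one exactly at
-- even-even columns, which locates the column j_m used by odd-odd columns.  Hence every column
-- of Φ(C) is an admissible transition at A j that moves the path from 2 A j to 2 A (j+1).

open import Defs
open import Data.Bool using (Bool; true; false; _∧_; T; T?; if_then_else_)
open import Data.Bool.Properties using (∧-identityʳ; ∧-zeroʳ; ∨-identityʳ; T-∧)
open import Data.Empty using (⊥-elim)
open import Data.Integer as ℤ using (+_)
import Data.Integer.Properties as ℤₚ
open import Data.Integer.Tactic.RingSolver using (solve-∀)
open import Data.List using (List; []; _∷_; length; map; upTo; applyUpTo; filterᵇ; concatMap; take; _++_)
open import Data.List.Properties using (length-++; ++-assoc; ++-identityʳ; concatMap-++; map-applyUpTo; map-++; upTo-∷ʳ)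
open import Data.List.Membership.Propositional using (_∈_)
open import Data.List.Membership.Propositional.Properties using (∈-map⁺; ∈-map⁻; ∈-upTo⁺; ∈-upTo⁻; ∈-filter⁺; ∈-filter⁻)
open import Data.List.Relation.Unary.Any using (here; there)
import Data.List.Relation.Unary.Linked as Linked
import Data.List.Relation.Unary.Linked.Properties as Linkedₚ
open import Data.Maybe using (just)
open import Data.Nat
open import Data.Nat.Properties
open import Algebra.Properties.CommutativeSemigroup +-commutativeSemigroup using () renaming (interchange to +-interchange)
open import Data.Product using (∃; _×_; _,_; proj₁; proj₂)
open import Data.Sum using (_⊎_; inj₁; inj₂)
open import Function.Bundles using (Equivalence)
open import Relation.Nullary using (¬_; yes; no; Dec)
open import Relation.Binary.Definitions using (tri<; tri≈; tri>)
open import Relation.Nullary.Decidable using (⌊_⌋; toWitness; fromWitness)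
open import Relation.Nullary.Reflects using (Reflects; ofʸ; ofⁿ; fromEquivalence)
open import Relation.Binary.PropositionalEquality

𝟙 : Bool → ℕ
𝟙 true  = 1
𝟙 false = 0

reflects-true : ∀ {P : Set} {b} → Reflects P b → P → b ≡ true
reflects-true (ofʸ _)  _ = refl
reflects-true (ofⁿ ¬p) p = ⊥-elim (¬p p)

reflects-false : ∀ {P : Set} {b} → Reflects P b → ¬ P → b ≡ false
reflects-false (ofʸ p) ¬p = ⊥-elim (¬p p)
reflects-false (ofⁿ _) _  = refl

reflects-holds : ∀ {P : Set} {b} → Reflects P b → b ≡ true → P
reflects-holds (ofʸ p) _ = p

reflects-fails : ∀ {P : Set} {b} → Reflects P b → b ≡ false → ¬ P
reflects-fails (ofⁿ ¬p) _ = ¬p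

≡ᵇ-reflects-≡ : ∀ m n → Reflects (m ≡ n) (m ≡ᵇ n)
≡ᵇ-reflects-≡ m n = fromEquivalence (≡ᵇ⇒≡ m n) (≡⇒≡ᵇ m n)

<ᵇ-true : ∀ {m n} → m < n → (m <ᵇ n) ≡ true
<ᵇ-true = reflects-true (<ᵇ-reflects-< _ _)

<ᵇ-false : ∀ {m n} → n ≤ m → (m <ᵇ n) ≡ false
<ᵇ-false n≤m = reflects-false (<ᵇ-reflects-< _ _) (≤⇒≯ n≤m)

≤ᵇ-true : ∀ {m n} → m ≤ n → (m ≤ᵇ n) ≡ true
≤ᵇ-true = reflects-true (≤ᵇ-reflects-≤ _ _)

≤ᵇ-false : ∀ {m n} → n < m → (m ≤ᵇ n) ≡ false
≤ᵇ-false n<m = reflects-false (≤ᵇ-reflects-≤ _ _) (<⇒≱ n<m)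

𝟙-<ᵇ-suc : ∀ c j → 𝟙 (c <ᵇ suc j) ≡ 𝟙 (c <ᵇ j) + 𝟙 (c ≡ᵇ j)
𝟙-<ᵇ-suc c j with <-cmp c j
... | tri< c<j c≢j _ rewrite <ᵇ-true (m<n⇒m<1+n c<j) | <ᵇ-true c<j
                           | reflects-false (≡ᵇ-reflects-≡ c j) c≢j = refl
... | tri≈ _ refl _ rewrite <ᵇ-true (n<1+n c) | <ᵇ-false (≤-refl {c})
                           | reflects-true (≡ᵇ-reflects-≡ c c) refl = refl
... | tri> _ c≢j j<c rewrite <ᵇ-false j<c | <ᵇ-false (<⇒≤ j<c)
                           | reflects-false (≡ᵇ-reflects-≡ c j) c≢j = refl

𝟙-≤ᵇ+𝟙-<ᵇ : ∀ i n → 𝟙 (i ≤ᵇ n) + 𝟙 (n <ᵇ i) ≡ 1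
𝟙-≤ᵇ+𝟙-<ᵇ i n with i ≤? n
... | yes i≤n rewrite ≤ᵇ-true i≤n | <ᵇ-false i≤n = refl
... | no  i≰n rewrite ≤ᵇ-false (≰⇒> i≰n) | <ᵇ-true (≰⇒> i≰n) = refl

𝟙-∧-split : ∀ b i n → 𝟙 (b ∧ (i ≤ᵇ n)) + 𝟙 (b ∧ (n <ᵇ i)) ≡ 𝟙 b
𝟙-∧-split true  i n = 𝟙-≤ᵇ+𝟙-<ᵇ i n
𝟙-∧-split false i n = refl

𝟙-∧-+ : ∀ a b c q → 𝟙 a ≡ 𝟙 b + 𝟙 c → 𝟙 (a ∧ q) ≡ 𝟙 (b ∧ q) + 𝟙 (c ∧ q)
𝟙-∧-+ a b c true  e rewrite ∧-identityʳ a | ∧-identityʳ b | ∧-identityʳ c = e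
𝟙-∧-+ a b c false e rewrite ∧-zeroʳ a | ∧-zeroʳ b | ∧-zeroʳ c = refl

𝟙-<ᵇ≤𝟙-≤ᵇ : ∀ m n → 𝟙 (m <ᵇ n) ≤ 𝟙 (m ≤ᵇ n)
𝟙-<ᵇ≤𝟙-≤ᵇ m n with m <? n
... | yes m<n rewrite <ᵇ-true m<n | ≤ᵇ-true (<⇒≤ m<n) = ≤-refl
... | no  m≮n rewrite <ᵇ-false (≮⇒≥ m≮n) = z≤n

inv-above : ∀ C {x i} → x < i → inv C x i ≡ (C i <ᵇ C x)
inv-above C {x} {i} x<i rewrite <ᵇ-false (<⇒≤ x<i) | <ᵇ-true x<i
                              | ∧-zeroʳ (C x <ᵇ C i) | ∧-identityʳ (C i <ᵇ C x) = refl

inv-below : ∀ C {x i} → i < x → inv C x i ≡ (C x <ᵇ C i)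
inv-below C {x} {i} i<x rewrite <ᵇ-true i<x | <ᵇ-false (<⇒≤ i<x)
                              | ∧-identityʳ (C x <ᵇ C i) | ∧-zeroʳ (C i <ᵇ C x)
                              | ∨-identityʳ (C x <ᵇ C i) = refl

sumFrom : (ℕ → ℕ) → ℕ → ℕ → ℕ
sumFrom g a zero    = 0
sumFrom g a (suc m) = g a + sumFrom g (suc a) m

sumRange : (ℕ → ℕ) → ℕ → ℕ → ℕ
sumRange g a b = sumFrom g a (b ∸ a)

Between : ℕ → ℕ → (ℕ → Set) → Set
Between a b P = ∀ i → a ≤ i → i < b → P i

-- A point of [a, a + (b - a)) lies below b (the range is empty when b < a).
below-end : ∀ {a b i} → a ≤ i → i < a + (b ∸ a) → i < b
below-end {a} {b} {i} a≤i i<end with a ≤? b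
... | yes a≤b = subst (i <_) (m+[n∸m]≡n a≤b) i<end
... | no  a≰b = ⊥-elim (<⇒≱ (subst (i <_) (trans (cong (_+_ a) (m≤n⇒m∸n≡0 (<⇒≤ (≰⇒> a≰b))))
                                                    (+-identityʳ a)) i<end) a≤i)

sumFrom-mono : ∀ g g' a m → Between a (a + m) (λ i → g i ≤ g' i) → sumFrom g a m ≤ sumFrom g' a m
sumFrom-mono g g' a zero    _  = z≤n
sumFrom-mono g g' a (suc m) le =
  +-mono-≤ (le a ≤-refl (m<m+n a z<s))
           (sumFrom-mono g g' (suc a) m (λ i a<i i<end → le i (<⇒≤ a<i) (subst (i <_) (sym (+-suc a m)) i<end)))

sumFrom-+ : ∀ g g' a m → sumFrom (λ i → g i + g' i) a m ≡ sumFrom g a m + sumFrom g' a m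
sumFrom-+ g g' a zero    = refl
sumFrom-+ g g' a (suc m) rewrite sumFrom-+ g g' (suc a) m = +-interchange (g a) (g' a) _ _

sumFrom-++ : ∀ g a m r → sumFrom g a (m + r) ≡ sumFrom g a m + sumFrom g (a + m) r
sumFrom-++ g a zero    r rewrite +-identityʳ a = refl
sumFrom-++ g a (suc m) r rewrite sumFrom-++ g (suc a) m r | +-suc a m = sym (+-assoc (g a) _ _)

sumFrom-const : ∀ c a m → sumFrom (λ _ → c) a m ≡ m * c
sumFrom-const c a zero    = refl
sumFrom-const c a (suc m) = cong (_+_ c) (sumFrom-const c (suc a) m)

sumRange-mono : ∀ g g' a b → Between a b (λ i → g i ≤ g' i) → sumRange g a b ≤ sumRange g' a b
sumRange-mono g g' a b le = sumFrom-mono g g' a (b ∸ a) (λ i a≤i i<end → le i a≤i (below-end a≤i i<end))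

sumRange-cong : ∀ g g' a b → Between a b (λ i → g i ≡ g' i) → sumRange g a b ≡ sumRange g' a b
sumRange-cong g g' a b eq = ≤-antisym (sumRange-mono g g' a b (λ i p q → ≤-reflexive (eq i p q)))
                                      (sumRange-mono g' g a b (λ i p q → ≤-reflexive (sym (eq i p q))))

sumRange-+ : ∀ g g' a b → sumRange (λ i → g i + g' i) a b ≡ sumRange g a b + sumRange g' a b
sumRange-+ g g' a b = sumFrom-+ g g' a (b ∸ a)

sumRange-split : ∀ g {a c b} → a ≤ c → c ≤ b → sumRange g a b ≡ sumRange g a c + sumRange g c b
sumRange-split g {a} {c} {b} a≤c c≤b = begin
  sumFrom g a (b ∸ a)                                   ≡⟨ cong (sumFrom g a) b-a ⟩
  sumFrom g a ((c ∸ a) + (b ∸ c))                       ≡⟨ sumFrom-++ g a (c ∸ a) (b ∸ c) ⟩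
  sumFrom g a (c ∸ a) + sumFrom g (a + (c ∸ a)) (b ∸ c) ≡⟨ cong (λ z → sumFrom g a (c ∸ a) + sumFrom g z (b ∸ c)) (m+[n∸m]≡n a≤c) ⟩
  sumRange g a c + sumRange g c b                       ∎
  where
  open ≡-Reasoning
  b-a : b ∸ a ≡ (c ∸ a) + (b ∸ c)
  b-a = trans (cong (_∸ a) (sym (m+[n∸m]≡n c≤b))) (+-∸-comm (b ∸ c) a≤c)

sumRange-first : ∀ g {a b} → a < b → sumRange g a b ≡ g a + sumRange g (suc a) b
sumRange-first g {a} {suc b} (s≤s a≤b) rewrite +-∸-assoc 1 a≤b = refl

sumRange-empty : ∀ g a → sumRange g a a ≡ 0
sumRange-empty g a rewrite n∸n≡0 a = refl

sumRange-const : ∀ c a b → sumRange (λ _ → c) a b ≡ (b ∸ a) * c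
sumRange-const c a b = sumFrom-const c a (b ∸ a)

sumRange-zero : ∀ g a b → Between a b (λ i → g i ≡ 0) → sumRange g a b ≡ 0
sumRange-zero g a b z = trans (sumRange-cong g (λ _ → 0) a b z) (trans (sumRange-const 0 a b) (*-zeroʳ (b ∸ a)))

sumRange-ones : ∀ g a b → Between a b (λ i → g i ≡ 1) → sumRange g a b ≡ b ∸ a
sumRange-ones g a b o = trans (sumRange-cong g (λ _ → 1) a b o) (trans (sumRange-const 1 a b) (*-identityʳ (b ∸ a)))

sumRange-sub : ∀ g g' {a' a b b'} → a' ≤ a → a ≤ b → b ≤ b' → Between a b (λ i → g i ≤ g' i) →
               sumRange g a b ≤ sumRange g' a' b'
sumRange-sub g g' {a'} {a} {b} {b'} a'≤a a≤b b≤b' le = begin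
  sumRange g a b                      ≤⟨ sumRange-mono g g' a b le ⟩
  sumRange g' a b                     ≤⟨ m≤n+m _ (sumRange g' a' a) ⟩
  sumRange g' a' a + sumRange g' a b  ≡⟨ sym (sumRange-split g' a'≤a a≤b) ⟩
  sumRange g' a' b                    ≤⟨ m≤m+n _ (sumRange g' b b') ⟩
  sumRange g' a' b + sumRange g' b b' ≡⟨ sym (sumRange-split g' (≤-trans a'≤a a≤b) b≤b') ⟩
  sumRange g' a' b'                   ∎
  where open ≤-Reasoning

count-∷ : ∀ (p : ℕ → Bool) x xs → count p (x ∷ xs) ≡ 𝟙 (p x) + count p xs
count-∷ p x xs with p x
... | true  = refl
... | false = refl

count-∧ : ∀ (p r : ℕ → Bool) xs → count (λ i → p i ∧ r i) xs ≡ count r (filterᵇ p xs)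
count-∧ p r []       = refl
count-∧ p r (x ∷ xs) rewrite count-∷ (λ i → p i ∧ r i) x xs with p x
... | true  = trans (cong (_+_ (𝟙 (r x))) (count-∧ p r xs)) (sym (count-∷ r x _))
... | false = count-∧ p r xs

count-applyUpTo : ∀ (p : ℕ → Bool) f a m → (∀ x → f x ≡ a + x) →
                  count p (applyUpTo f m) ≡ sumFrom (λ i → 𝟙 (p i)) a m
count-applyUpTo p f a zero    _  = refl
count-applyUpTo p f a (suc m) fx = begin
  count p (f 0 ∷ applyUpTo (λ x → f (suc x)) m)        ≡⟨ count-∷ p (f 0) _ ⟩
  𝟙 (p (f 0)) + count p (applyUpTo (λ x → f (suc x)) m) ≡⟨ cong₂ (λ u v → 𝟙 (p u) + v) (trans (fx 0) (+-identityʳ a))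
                                                            (count-applyUpTo p _ (suc a) m (λ x → trans (fx (suc x)) (+-suc a x))) ⟩
  𝟙 (p a) + sumFrom (λ i → 𝟙 (p i)) (suc a) m          ∎
  where open ≡-Reasoning

count-interval : ∀ (p : ℕ → Bool) lo hi → count p (interval lo hi) ≡ sumRange (λ i → 𝟙 (p i)) lo (suc hi)
count-interval p lo hi = trans (cong (count p) (map-applyUpTo (λ x → x) (λ x → lo + x) (suc hi ∸ lo)))
                               (count-applyUpTo p (λ x → lo + x) lo (suc hi ∸ lo) (λ x → refl))

∈-interval⁻ : ∀ {lo hi x} → x ∈ interval lo hi → lo ≤ x × x ≤ hi
∈-interval⁻ {lo} x∈ with ∈-map⁻ (λ x → lo + x) x∈
... | k , k∈ , refl = m≤m+n lo k , ≤-pred (below-end (m≤m+n lo k) (+-monoʳ-< lo (∈-upTo⁻ k∈)))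

∈-interval⁺ : ∀ {lo hi x} → lo ≤ x → x ≤ hi → x ∈ interval lo hi
∈-interval⁺ {lo} {hi} {x} lo≤x x≤hi =
  subst (_∈ interval lo hi) (m+[n∸m]≡n lo≤x) (∈-map⁺ (λ k → lo + k) (∈-upTo⁺ (∸-monoˡ-< (s≤s x≤hi) lo≤x)))

interval-ascending : ∀ lo hi → Linked.Linked _<_ (interval lo hi)
interval-ascending lo hi = Linkedₚ.map⁺ (Linkedₚ.applyUpTo⁺₂ (λ x → x) _ (λ i → +-monoʳ-< lo (n<1+n i)))

lastD-∈ : ∀ {c} xs → c ∈ xs → lastD xs ∈ xs
lastD-∈ (x ∷ [])     _ = here refl
lastD-∈ (x ∷ y ∷ ys) _ = there (lastD-∈ (y ∷ ys) (here refl))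

ht-++ : ∀ xs ys → ht (xs ++ ys) ≡ ht xs ℤ.+ ht ys
ht-++ []       ys = sym (ℤₚ.+-identityˡ (ht ys))
ht-++ (U ∷ xs) ys = trans (cong (ℤ._+_ (+ 1)) (ht-++ xs ys)) (sym (ℤₚ.+-assoc (+ 1) (ht xs) (ht ys)))
ht-++ (D ∷ xs) ys = trans (cong (ℤ._+_ (ℤ.- + 1)) (ht-++ xs ys)) (sym (ℤₚ.+-assoc (ℤ.- + 1) (ht xs) (ht ys)))

downs-++ : ∀ xs ys → downs (xs ++ ys) ≡ downs xs + downs ys
downs-++ []       ys = refl
downs-++ (U ∷ xs) ys = downs-++ xs ys
downs-++ (D ∷ xs) ys = cong suc (downs-++ xs ys)

-- Height plus twice the number of down steps is the length: a path of length 2n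
-- ending at height 0 has exactly n down steps.
ht-downs-length : ∀ γ → ht γ ℤ.+ + (2 * downs γ) ≡ + length γ
ht-downs-length []      = refl
ht-downs-length (U ∷ γ) = begin
  (+ 1 ℤ.+ ht γ) ℤ.+ + (2 * downs γ) ≡⟨ ℤₚ.+-assoc (+ 1) (ht γ) _ ⟩
  + 1 ℤ.+ (ht γ ℤ.+ + (2 * downs γ)) ≡⟨ cong (ℤ._+_ (+ 1)) (ht-downs-length γ) ⟩
  + suc (length γ)                   ∎
  where open ≡-Reasoning
ht-downs-length (D ∷ γ) = begin
  (ℤ.- + 1 ℤ.+ ht γ) ℤ.+ + (2 * suc (downs γ))     ≡⟨ cong (λ z → (ℤ.- + 1 ℤ.+ ht γ) ℤ.+ + z) (*-suc 2 (downs γ)) ⟩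
  (ℤ.- + 1 ℤ.+ ht γ) ℤ.+ (+ 2 ℤ.+ + (2 * downs γ)) ≡⟨ shuffle (ht γ) (+ (2 * downs γ)) ⟩
  + 1 ℤ.+ (ht γ ℤ.+ + (2 * downs γ))               ≡⟨ cong (ℤ._+_ (+ 1)) (ht-downs-length γ) ⟩
  + suc (length γ)                                 ∎
  where
  open ≡-Reasoning
  shuffle : ∀ h x → (ℤ.- + 1 ℤ.+ h) ℤ.+ (+ 2 ℤ.+ x) ≡ + 1 ℤ.+ (h ℤ.+ x)
  shuffle = solve-∀

take-++ : ∀ {A : Set} (xs ys : List A) t → take (length xs + t) (xs ++ ys) ≡ xs ++ take t ys
take-++ []       ys t = refl
take-++ (x ∷ xs) ys t = cong (x ∷_) (take-++ xs ys t)

at-++ : ∀ {A : Set} (xs ys : List A) t → at (xs ++ ys) (length xs + t) ≡ at ys t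
at-++ []       ys t = refl
at-++ (x ∷ xs) ys t = at-++ xs ys t

up-up-height : ∀ a → + (2 * a) ℤ.+ ht (U ∷ U ∷ []) ≡ + (2 * suc a)
up-up-height a = cong +_ (trans (+-comm (2 * a) 2) (sym (*-suc 2 a)))

mixed-height : ∀ a b → + (2 * a) ℤ.+ ht (if b then D ∷ U ∷ [] else U ∷ D ∷ []) ≡ + (2 * a)
mixed-height a true  = ℤₚ.+-identityʳ _
mixed-height a false = ℤₚ.+-identityʳ _

down-down-height : ∀ a → + (2 * suc a) ℤ.+ ht (D ∷ D ∷ []) ≡ + (2 * a)
down-down-height a = trans (cong (ℤ._⊖ 2) (*-suc 2 a)) (ℤₚ.⊖-≥ (m≤m+n 2 (2 * a)))

+2*-injective : ∀ {a b} → + (2 * a) ≡ + (2 * b) → a ≡ b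
+2*-injective e = *-cancelˡ-≡ _ _ 2 (ℤₚ.+-injective e)

+-minus-+ : ∀ a b → + (a + b) ℤ.- + a ≡ + b
+-minus-+ a b = trans (ℤₚ.m-n≡m⊖n (a + b) a) (trans (ℤₚ.⊖-≥ (m≤m+n a b)) (cong +_ (m+n∸m≡n a b)))

-- The admissible contributions of one column to a Dellac history whose path is at height 2k
-- before the column: its two steps and the ξ-entries attached to its down steps.
data Transition (k : ℕ) : List Step → List (ℕ × ℕ) → Set where
  up-up     : Transition k (U ∷ U ∷ []) []
  down-up   : ∀ {a b} → a ≤ k → b < a → Transition k (D ∷ U ∷ []) ((a , b) ∷ [])
  up-down   : ∀ {a b} → a ≤ b → b ≤ k → Transition k (U ∷ D ∷ []) ((a , b) ∷ [])
  down-down : ∀ {a b c d} → a + 1 ≤ k → b ≤ a → c ≤ d → d + 1 ≤ k →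
              Transition k (D ∷ D ∷ []) ((a , b) ∷ (c , d) ∷ [])

transition-length : ∀ {k S Z} → Transition k S Z → length S ≡ 2
transition-length up-up               = refl
transition-length (down-up _ _)       = refl
transition-length (up-down _ _)       = refl
transition-length (down-down _ _ _ _) = refl

transition-entries : ∀ {k S Z} → Transition k S Z → length Z ≡ downs S
transition-entries up-up               = refl
transition-entries (down-up _ _)       = refl
transition-entries (up-down _ _)       = refl
transition-entries (down-down _ _ _ _) = refl

-- A transition starting with a down step needs k ≥ 1, so the path stays non-negative.
transition-first-step : ∀ {k S Z} → Transition k S Z → ∀ R → + 0 ℤ.≤ + (2 * k) ℤ.+ ht (take 1 (S ++ R))
transition-first-step up-up                           R = ℤ.+≤+ z≤n
transition-first-step (up-down _ _)                   R = ℤ.+≤+ z≤n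
transition-first-step {suc k} (down-up _ _)           R = ℤ.+≤+ z≤n
transition-first-step {suc k} (down-down _ _ _ _)     R = ℤ.+≤+ z≤n
transition-first-step {zero} (down-up a≤0 b<a)        R = ⊥-elim (<⇒≱ (≤-<-trans z≤n b<a) a≤0)
transition-first-step {zero} (down-down a+1≤0 _ _ _)  R = ⊥-elim (<⇒≱ (m<m+n _ z<s) (≤-trans a+1≤0 z≤n))

ColumnCondition : ℕ → List Step → List (ℕ × ℕ) → Set
ColumnCondition k S Z =
    (at S 0 ≡ just D → at S 1 ≡ just U → ∀ a b → at Z 0 ≡ just (a , b) → (a ≤ k) × (b < a))
  × (at S 0 ≡ just U → at S 1 ≡ just D → ∀ a b → at Z 0 ≡ just (a , b) → (a ≤ b) × (b ≤ k))
  × (at S 0 ≡ just D → at S 1 ≡ just D → ∀ a b c d → at Z 0 ≡ just (a , b) → at Z 1 ≡ just (c , d) →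
      (a + 1 ≤ k) × (b ≤ a) × (c ≤ d) × (d + 1 ≤ k))

transition-condition : ∀ {k S Z} → Transition k S Z → ∀ R R' → ColumnCondition k (S ++ R) (Z ++ R')
transition-condition up-up                  R R' = (λ ()) , (λ _ ()) , (λ ())
transition-condition (down-up a≤k b<a)      R R' = (λ { _ _ _ _ refl → a≤k , b<a }) , (λ ()) , (λ _ ())
transition-condition (up-down a≤b b≤k)      R R' = (λ ()) , (λ { _ _ _ _ refl → a≤b , b≤k }) , (λ ())
transition-condition (down-down p q r s)    R R' = (λ _ ()) , (λ ()) , (λ { _ _ _ _ _ _ refl refl → p , q , r , s })

take-prefix : ∀ {A : Set} (xs ys : List A) {m} → length xs ≡ m → take m (xs ++ ys) ≡ xs
take-prefix xs ys refl = trans (cong (λ t → take t (xs ++ ys)) (sym (+-identityʳ _))) (trans (take-++ xs ys 0) (++-identityʳ xs))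

at-after : ∀ {A : Set} (xs ys : List A) {m} t → length xs ≡ m → at (xs ++ ys) (t + m) ≡ at ys t
at-after xs ys t refl = trans (cong (at (xs ++ ys)) (+-comm t _)) (at-++ xs ys t)

condition-after : ∀ n (P S : List Step) (X Z : List (ℕ × ℕ)) q {k} → length P ≡ 2 * q → length X ≡ downs P →
                  ht P ≡ + (2 * k) → ColumnCondition k S Z → DHcond n (P ++ S) (X ++ Z) (suc q)
condition-after n P S X Z q {k} lP lX hP cond k' hk'
  rewrite take-prefix P S lP | at-after P S 0 lP | at-after P S 1 lP | at-after X Z 0 lX | at-after X Z 1 lX =
  subst (λ m → ColumnCondition m S Z) (+2*-injective (trans (sym hP) hk')) cond

interval-snoc : ∀ m → interval 1 (suc m) ≡ interval 1 m ++ (suc m ∷ [])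
interval-snoc m = trans (cong (map suc) (sym (upTo-∷ʳ m))) (map-++ suc (upTo m) (m ∷ []))

interval-split : ∀ {q n} → q ≤ n → ∃ λ R → interval 1 n ≡ interval 1 q ++ R
interval-split {q} {n} q≤n with m≤n⇒m<n∨m≡n q≤n
... | inj₂ refl = [] , sym (++-identityʳ _)
interval-split {q} {suc n} _ | inj₁ (s≤s q≤n) with interval-split q≤n
... | R , e = R ++ (suc n ∷ []) ,
  trans (interval-snoc n) (trans (cong (_++ (suc n ∷ [])) e) (++-assoc (interval 1 q) R _))

module _ {A : Set} (h : ℕ → List A) where

  concatMap-snoc : ∀ m → concatMap h (interval 1 (suc m)) ≡ concatMap h (interval 1 m) ++ h (suc m)
  concatMap-snoc m = trans (cong (concatMap h) (interval-snoc m))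
                           (trans (concatMap-++ h (interval 1 m) _) (cong (concatMap h (interval 1 m) ++_) (++-identityʳ _)))

  concatMap-split : ∀ {q n} → q < n →
                    ∃ λ R → concatMap h (interval 1 n) ≡ concatMap h (interval 1 q) ++ (h (suc q) ++ R)
  concatMap-split {q} {n} q<n with interval-split q<n
  ... | R , e = concatMap h R , (begin
    concatMap h (interval 1 n)                                  ≡⟨ cong (concatMap h) e ⟩
    concatMap h (interval 1 (suc q) ++ R)                       ≡⟨ concatMap-++ h (interval 1 (suc q)) R ⟩
    concatMap h (interval 1 (suc q)) ++ concatMap h R           ≡⟨ cong (_++ concatMap h R) (concatMap-snoc q) ⟩
    (concatMap h (interval 1 q) ++ h (suc q)) ++ concatMap h R  ≡⟨ ++-assoc (concatMap h (interval 1 q)) _ _ ⟩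
    concatMap h (interval 1 q) ++ (h (suc q) ++ concatMap h R)  ∎)
    where open ≡-Reasoning

even-or-odd : ∀ t → ∃ λ q → (t ≡ 2 * q) ⊎ (t ≡ suc (2 * q))
even-or-odd zero = 0 , inj₁ refl
even-or-odd (suc t) with even-or-odd t
... | q , inj₁ refl = q , inj₂ refl
... | q , inj₂ refl = suc q , inj₁ (cong suc (sym (+-suc q (q + 0))))

module ColumnSequence (n : ℕ) (f : ℕ → List Step) (g : ℕ → List (ℕ × ℕ)) (K : ℕ → ℕ)
  (admissible  : ∀ j → 1 ≤ j → j ≤ n → Transition (K j) (f j) (g j))
  (height-step : ∀ j → 1 ≤ j → j ≤ n → + (2 * K j) ℤ.+ ht (f j) ≡ + (2 * K (suc j)))
  (K-start : K 1 ≡ 0) (K-end : K (suc n) ≡ 0) where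

  path : ℕ → List Step
  path m = concatMap f (interval 1 m)

  entries : ℕ → List (ℕ × ℕ)
  entries m = concatMap g (interval 1 m)

  path-length : ∀ m → m ≤ n → length (path m) ≡ 2 * m
  path-length zero    _   = refl
  path-length (suc m) m<n = begin
    length (path (suc m))                ≡⟨ cong length (concatMap-snoc f m) ⟩
    length (path m ++ f (suc m))         ≡⟨ length-++ (path m) ⟩
    length (path m) + length (f (suc m)) ≡⟨ cong₂ _+_ (path-length m (<⇒≤ m<n)) (transition-length (admissible (suc m) (s≤s z≤n) m<n)) ⟩
    2 * m + 2                            ≡⟨ +-comm (2 * m) 2 ⟩
    2 + 2 * m                            ≡⟨ *-suc 2 m ⟨
    2 * suc m                            ∎
    where open ≡-Reasoning

  entries-length : ∀ m → m ≤ n → length (entries m) ≡ downs (path m)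
  entries-length zero    _   = refl
  entries-length (suc m) m<n = begin
    length (entries (suc m))                     ≡⟨ cong length (concatMap-snoc g m) ⟩
    length (entries m ++ g (suc m))              ≡⟨ length-++ (entries m) ⟩
    length (entries m) + length (g (suc m))      ≡⟨ cong₂ _+_ (entries-length m (<⇒≤ m<n)) (transition-entries (admissible (suc m) (s≤s z≤n) m<n)) ⟩
    downs (path m) + downs (f (suc m))           ≡⟨ downs-++ (path m) (f (suc m)) ⟨
    downs (path m ++ f (suc m))                  ≡⟨ cong downs (concatMap-snoc f m) ⟨
    downs (path (suc m))                         ∎
    where open ≡-Reasoning

  path-height : ∀ m → m ≤ n → ht (path m) ≡ + (2 * K (suc m))
  path-height zero    _   = cong (λ k → + (2 * k)) (sym K-start)
  path-height (suc m) m<n = begin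
    ht (path (suc m))                    ≡⟨ cong ht (concatMap-snoc f m) ⟩
    ht (path m ++ f (suc m))             ≡⟨ ht-++ (path m) (f (suc m)) ⟩
    ht (path m) ℤ.+ ht (f (suc m))       ≡⟨ cong (ℤ._+ ht (f (suc m))) (path-height m (<⇒≤ m<n)) ⟩
    + (2 * K (suc m)) ℤ.+ ht (f (suc m)) ≡⟨ height-step (suc m) (s≤s z≤n) m<n ⟩
    + (2 * K (suc (suc m)))              ∎
    where open ≡-Reasoning

  -- Every prefix of the path stays weakly above the axis: a prefix of even length 2q ends at
  -- height 2 K (q + 1), one of odd length takes one more step, allowed by transition-first-step.
  even-prefix : ∀ q → q ≤ n → + 0 ℤ.≤ ht (take (2 * q) (path n))
  even-prefix q q≤n with interval-split q≤n
  ... | R , e rewrite e | concatMap-++ f (interval 1 q) R | take-prefix (path q) (concatMap f R) (path-length q q≤n)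
                    | path-height q q≤n = ℤ.+≤+ z≤n

  odd-prefix : ∀ q → q < n → + 0 ℤ.≤ ht (take (suc (2 * q)) (path n))
  odd-prefix q q<n with concatMap-split f q<n
  ... | R , e rewrite e | sym (path-length q (<⇒≤ q<n)) | +-comm 1 (length (path q))
                    | take-++ (path q) (f (suc q) ++ R) 1 | ht-++ (path q) (take 1 (f (suc q) ++ R))
                    | path-height q (<⇒≤ q<n) = transition-first-step (admissible (suc q) (s≤s z≤n) q<n) R

  path-nonnegative : ∀ t → t ≤ 2 * n → + 0 ℤ.≤ ht (take t (path n))
  path-nonnegative t t≤2n with even-or-odd t
  ... | q , inj₁ refl = even-prefix q (*-cancelˡ-≤ 2 t≤2n)
  ... | q , inj₂ refl = odd-prefix q (*-cancelˡ-< 2 q n (≤-trans (n<1+n _) t≤2n))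

  column-condition : ∀ j → 1 ≤ j → j ≤ n → DHcond n (path n) (entries n) j
  column-condition (suc q) _ q<n with concatMap-split f q<n | concatMap-split g q<n
  ... | R , eγ | R' , eξ rewrite eγ | eξ =
    condition-after n (path q) (f (suc q) ++ R) (entries q) (g (suc q) ++ R') q
      (path-length q (<⇒≤ q<n)) (entries-length q (<⇒≤ q<n)) (path-height q (<⇒≤ q<n))
      (transition-condition (admissible (suc q) (s≤s z≤n) q<n) R R')

  path-returns : ht (path n) ≡ + 0
  path-returns = trans (path-height n ≤-refl) (cong (λ k → + (2 * k)) K-end)

  -- The path has length 2n and returns to height 0, so it has n down steps, one ξ-entry each.
  path-downs : downs (path n) ≡ n
  path-downs = +2*-injective (begin
    + (2 * downs (path n))                     ≡⟨ ℤₚ.+-identityˡ _ ⟨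
    + 0 ℤ.+ + (2 * downs (path n))             ≡⟨ cong (ℤ._+ + (2 * downs (path n))) path-returns ⟨
    ht (path n) ℤ.+ + (2 * downs (path n))     ≡⟨ ht-downs-length (path n) ⟩
    + length (path n)                          ≡⟨ cong +_ (path-length n ≤-refl) ⟩
    + (2 * n)                                  ∎)
    where open ≡-Reasoning

  dellac-history : DH n (path n , entries n)
  dellac-history = (path-length n ≤-refl , path-nonnegative , path-returns)
                 , trans (entries-length n ≤-refl) path-downs
                 , column-condition

module Configuration (n : ℕ) (C : ℕ → ℕ) (dc : DC n C) where

  column-pos : ∀ {i} → 1 ≤ i → i ≤ 2 * n → 1 ≤ C i
  column-pos p q = proj₁ (proj₁ dc _ p q)

  column-≤-row : ∀ {i} → 1 ≤ i → i ≤ 2 * n → C i ≤ i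
  column-≤-row p q = proj₁ (proj₂ (proj₂ (proj₁ dc _ p q)))

  row-≤-column+n : ∀ {i} → 1 ≤ i → i ≤ 2 * n → i ≤ C i + n
  row-≤-column+n p q = proj₂ (proj₂ (proj₂ (proj₁ dc _ p q)))

  allRows : List ℕ
  allRows = interval 1 (2 * n)

  record Column (j : ℕ) : Set where
    field
      x y  : ℕ
      rows : colRows n C j ≡ x ∷ y ∷ []
      1≤x  : 1 ≤ x
      x<y  : x < y
      y≤2n : y ≤ 2 * n
      Cx   : C x ≡ j
      Cy   : C y ≡ j

  column : ∀ j → 1 ≤ j → j ≤ n → Column j
  column j 1≤j j≤n with colRows n C j in eq | proj₂ dc j 1≤j j≤n
  ... | x ∷ y ∷ [] | _ = record
    { x = x ; y = y ; rows = eq ; 1≤x = proj₁ (∈-interval⁻ (proj₁ x-dot)) ; x<y = Linked.head ascending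
    ; y≤2n = proj₂ (∈-interval⁻ (proj₁ y-dot)) ; Cx = in-column x-dot ; Cy = in-column y-dot }
    where
    in-column? : ∀ i → Dec (T (C i ≡ᵇ j))
    in-column? i = T? (C i ≡ᵇ j)
    ascending : Linked.Linked _<_ (x ∷ y ∷ [])
    ascending = subst (Linked.Linked _<_) eq (Linkedₚ.filter⁺ in-column? <-trans (interval-ascending 1 (2 * n)))
    x-dot : x ∈ allRows × T (C x ≡ᵇ j)
    x-dot = ∈-filter⁻ in-column? (subst (x ∈_) (sym eq) (here refl))
    y-dot : y ∈ allRows × T (C y ≡ᵇ j)
    y-dot = ∈-filter⁻ in-column? (subst (y ∈_) (sym eq) (there (here refl)))
    in-column : ∀ {i} → i ∈ allRows × T (C i ≡ᵇ j) → C i ≡ j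
    in-column (_ , t) = ≡ᵇ⇒≡ _ j t

  open Column

  data Kind {j} (c : Column j) : Set where
    even-even : y c ≤ n → Kind c
    even-odd  : x c ≤ n → n < y c → Kind c
    odd-odd   : n < x c → Kind c

  kind : ∀ {j} (c : Column j) → Kind c
  kind c with y c ≤? n | x c ≤? n
  ... | yes y≤n | _       = even-even y≤n
  ... | no  y≰n | yes x≤n = even-odd x≤n (≰⇒> y≰n)
  ... | no  _   | no  x≰n = odd-odd (≰⇒> x≰n)

  module _ {j} (c : Column j) where

    i₁≡x : i₁ n C j ≡ x c
    i₁≡x = cong (λ l → atD l 0) (rows c)

    i₂≡y : i₂ n C j ≡ y c
    i₂≡y = cong (λ l → atD l 1) (rows c)

    1≤y : 1 ≤ y c
    1≤y = ≤-trans (1≤x c) (<⇒≤ (x<y c))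

    x≤2n : x c ≤ 2 * n
    x≤2n = ≤-trans (<⇒≤ (x<y c)) (y≤2n c)

    -- Since C i ≤ i ≤ C i + n, both dots of column j lie in rows j..n+j.
    j≤x : j ≤ x c
    j≤x = subst (_≤ x c) (Cx c) (column-≤-row (1≤x c) x≤2n)

    y≤n+j : y c ≤ n + j
    y≤n+j = subst (y c ≤_) (trans (cong (_+ n) (Cy c)) (+-comm j n)) (row-≤-column+n 1≤y (y≤2n c))

    even-dots : count (λ i → (C i ≡ᵇ j) ∧ (i ≤ᵇ n)) allRows ≡ 𝟙 (x c ≤ᵇ n) + 𝟙 (y c ≤ᵇ n)
    even-dots = begin
      count (λ i → (C i ≡ᵇ j) ∧ (i ≤ᵇ n)) allRows ≡⟨ count-∧ (λ i → C i ≡ᵇ j) (λ i → i ≤ᵇ n) allRows ⟩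
      count (λ i → i ≤ᵇ n) (colRows n C j)                      ≡⟨ cong (count (λ i → i ≤ᵇ n)) (rows c) ⟩
      count (λ i → i ≤ᵇ n) (x c ∷ y c ∷ [])                     ≡⟨ count-∷ (λ i → i ≤ᵇ n) (x c) (y c ∷ []) ⟩
      𝟙 (x c ≤ᵇ n) + count (λ i → i ≤ᵇ n) (y c ∷ [])            ≡⟨ cong (_+_ (𝟙 (x c ≤ᵇ n))) (trans (count-∷ (λ i → i ≤ᵇ n) (y c) []) (+-identityʳ _)) ⟩
      𝟙 (x c ≤ᵇ n) + 𝟙 (y c ≤ᵇ n)                               ∎
      where open ≡-Reasoning

  n≤2n : n ≤ 2 * n
  n≤2n = m≤m+n n (n + 0)

  -- A j: the even dots of rows j..n that lie in columns < j.  It will be the half-height of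
  -- the path before column j.
  A : ℕ → ℕ
  A j = sumRange (λ i → 𝟙 (C i <ᵇ j)) j (suc n)

  B : ℕ → ℕ
  B j = sumRange (λ i → 𝟙 (j ≤ᵇ C i)) (suc n) (n + j)

  E O : ℕ → ℕ
  E j = count (λ i → (C i <ᵇ j) ∧ (i ≤ᵇ n)) allRows
  O j = count (λ i → (C i <ᵇ j) ∧ (n <ᵇ i)) allRows

  -- The rows 1..m are even and have their dots in columns ≤ m; the rows m+1..n contribute A (m+1).
  E-closed : ∀ m → m ≤ n → E (suc m) ≡ m + A (suc m)
  E-closed m m≤n = begin
    E (suc m)                                                     ≡⟨ count-interval _ 1 (2 * n) ⟩
    sumRange f 1 (suc (2 * n))                                    ≡⟨ sumRange-split f (s≤s z≤n) (s≤s (≤-trans m≤n n≤2n)) ⟩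
    sumRange f 1 (suc m) + sumRange f (suc m) (suc (2 * n))       ≡⟨ cong (_+_ (sumRange f 1 (suc m))) (sumRange-split f (s≤s m≤n) (s≤s n≤2n)) ⟩
    sumRange f 1 (suc m) + (sumRange f (suc m) (suc n) + sumRange f (suc n) (suc (2 * n)))
      ≡⟨ cong₂ (λ u v → u + (v + sumRange f (suc n) (suc (2 * n)))) (sumRange-ones f 1 (suc m) low) (sumRange-cong _ _ (suc m) (suc n) mid) ⟩
    m + (A (suc m) + sumRange f (suc n) (suc (2 * n)))            ≡⟨ cong (λ v → m + (A (suc m) + v)) (sumRange-zero f (suc n) (suc (2 * n)) high) ⟩
    m + (A (suc m) + 0)                                           ≡⟨ cong (_+_ m) (+-identityʳ _) ⟩
    m + A (suc m)                                                 ∎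
    where
    open ≡-Reasoning
    f : ℕ → ℕ
    f i = 𝟙 ((C i <ᵇ suc m) ∧ (i ≤ᵇ n))
    low : Between 1 (suc m) (λ i → f i ≡ 1)
    low i 1≤i i≤m rewrite <ᵇ-true (≤-<-trans (column-≤-row 1≤i (≤-trans (≤-pred i≤m) (≤-trans m≤n n≤2n))) i≤m)
                        | ≤ᵇ-true (≤-trans (≤-pred i≤m) m≤n) = refl
    mid : Between (suc m) (suc n) (λ i → f i ≡ 𝟙 (C i <ᵇ suc m))
    mid i _ i≤n rewrite ≤ᵇ-true (≤-pred i≤n) = cong 𝟙 (∧-identityʳ _)
    high : Between (suc n) (suc (2 * n)) (λ i → f i ≡ 0)
    high i n<i _ rewrite ≤ᵇ-false n<i = cong 𝟙 (∧-zeroʳ _)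

  -- Each odd row n+i with i ≤ m holds a dot of column ≤ m or one counted by B (m+1); the odd rows
  -- beyond n+m have their dots in columns > m.
  O-closed : ∀ m → m ≤ n → O (suc m) + B (suc m) ≡ m
  O-closed m m≤n = begin
    O (suc m) + B (suc m)                                    ≡⟨ cong (_+ B (suc m)) (count-interval _ 1 (2 * n)) ⟩
    sumRange g 1 (suc (2 * n)) + B (suc m)                   ≡⟨ cong (_+ B (suc m)) split ⟩
    (0 + (sumRange g (suc n) end + 0)) + B (suc m)           ≡⟨ cong (_+ B (suc m)) (+-identityʳ _) ⟩
    sumRange g (suc n) end + B (suc m)                       ≡⟨ sumRange-+ g G (suc n) end ⟨
    sumRange (λ i → g i + G i) (suc n) end                   ≡⟨ sumRange-ones _ (suc n) end mid ⟩
    end ∸ suc n                                              ≡⟨ cong (_∸ suc n) (+-suc n m) ⟩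
    suc n + m ∸ suc n                                        ≡⟨ m+n∸m≡n (suc n) m ⟩
    m                                                        ∎
    where
    open ≡-Reasoning
    end : ℕ
    end = n + suc m
    g G : ℕ → ℕ
    g i = 𝟙 ((C i <ᵇ suc m) ∧ (n <ᵇ i))
    G i = 𝟙 (suc m ≤ᵇ C i)
    end≤ : end ≤ suc (2 * n)
    end≤ = subst (_≤ suc (2 * n)) (sym (+-suc n m)) (s≤s (+-monoʳ-≤ n (≤-trans m≤n (m≤m+n n 0))))
    low : Between 1 (suc n) (λ i → g i ≡ 0)
    low i _ i≤n rewrite <ᵇ-false (≤-pred i≤n) = cong 𝟙 (∧-zeroʳ _)
    mid : Between (suc n) end (λ i → g i + G i ≡ 1)
    mid i n<i _ rewrite <ᵇ-true n<i | ∧-identityʳ (C i <ᵇ suc m) = trans (+-comm (𝟙 (C i <ᵇ suc m)) _) (𝟙-≤ᵇ+𝟙-<ᵇ (suc m) (C i))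
    high : Between end (suc (2 * n)) (λ i → g i ≡ 0)
    high i end≤i i≤2n rewrite <ᵇ-false (+-cancelʳ-≤ n (suc m) (C i) (subst (_≤ C i + n) (+-comm n (suc m))
                                 (≤-trans end≤i (row-≤-column+n (≤-trans (≤-trans (s≤s z≤n) (m≤n+m (suc m) n)) end≤i) (≤-pred i≤2n))))) = refl
    split : sumRange g 1 (suc (2 * n)) ≡ 0 + (sumRange g (suc n) end + 0)
    split = begin
      sumRange g 1 (suc (2 * n))                                       ≡⟨ sumRange-split g (s≤s z≤n) (s≤s n≤2n) ⟩
      sumRange g 1 (suc n) + sumRange g (suc n) (suc (2 * n))          ≡⟨ cong (_+_ (sumRange g 1 (suc n))) (sumRange-split g (subst (suc n ≤_) (sym (+-suc n m)) (m≤m+n (suc n) m)) end≤) ⟩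
      sumRange g 1 (suc n) + (sumRange g (suc n) end + sumRange g end (suc (2 * n)))
        ≡⟨ cong₂ (λ u v → u + (sumRange g (suc n) end + v)) (sumRange-zero g 1 (suc n) low) (sumRange-zero g end (suc (2 * n)) high) ⟩
      0 + (sumRange g (suc n) end + 0)                                 ∎

  dots-left-of : ∀ m → m ≤ n → count (λ i → C i <ᵇ suc m) allRows ≡ 2 * m
  dots-left-of zero _ = trans (count-interval _ 1 (2 * n))
    (sumRange-zero _ 1 (suc (2 * n)) (λ i 1≤i i≤2n → cong 𝟙 (<ᵇ-false (column-pos 1≤i (≤-pred i≤2n)))))
  dots-left-of (suc m) m<n = begin
    count (λ i → C i <ᵇ suc (suc m)) allRows                     ≡⟨ count-interval _ 1 (2 * n) ⟩
    sumRange (λ i → 𝟙 (C i <ᵇ suc (suc m))) 1 end                ≡⟨ sumRange-cong _ _ 1 end (λ i _ _ → 𝟙-<ᵇ-suc (C i) (suc m)) ⟩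
    sumRange (λ i → left i + this i) 1 end                       ≡⟨ sumRange-+ left this 1 end ⟩
    sumRange left 1 end + sumRange this 1 end                    ≡⟨ cong₂ _+_ (count-interval _ 1 (2 * n)) (count-interval _ 1 (2 * n)) ⟨
    count (λ i → C i <ᵇ suc m) allRows + count (λ i → C i ≡ᵇ suc m) allRows
                                                                 ≡⟨ cong₂ _+_ (dots-left-of m (<⇒≤ m<n)) (proj₂ dc (suc m) (s≤s z≤n) m<n) ⟩
    2 * m + 2                                                    ≡⟨ +-comm (2 * m) 2 ⟩
    2 + 2 * m                                                    ≡⟨ *-suc 2 m ⟨
    2 * suc m                                                    ∎
    where
    open ≡-Reasoning
    end : ℕ
    end = suc (2 * n)
    left this : ℕ → ℕ
    left i = 𝟙 (C i <ᵇ suc m)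
    this i = 𝟙 (C i ≡ᵇ suc m)

  E+O : ∀ m → m ≤ n → E (suc m) + O (suc m) ≡ 2 * m
  E+O m m≤n = begin
    E (suc m) + O (suc m)                          ≡⟨ cong₂ _+_ (count-interval _ 1 (2 * n)) (count-interval _ 1 (2 * n)) ⟩
    sumRange even 1 end + sumRange odd 1 end       ≡⟨ sumRange-+ even odd 1 end ⟨
    sumRange (λ i → even i + odd i) 1 end          ≡⟨ sumRange-cong _ _ 1 end (λ i _ _ → 𝟙-∧-split (C i <ᵇ suc m) i n) ⟩
    sumRange (λ i → 𝟙 (C i <ᵇ suc m)) 1 end        ≡⟨ count-interval _ 1 (2 * n) ⟨
    count (λ i → C i <ᵇ suc m) allRows             ≡⟨ dots-left-of m m≤n ⟩
    2 * m                                          ∎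
    where
    open ≡-Reasoning
    end : ℕ
    end = suc (2 * n)
    even odd : ℕ → ℕ
    even i = 𝟙 ((C i <ᵇ suc m) ∧ (i ≤ᵇ n))
    odd i  = 𝟙 ((C i <ᵇ suc m) ∧ (n <ᵇ i))

  A≡B : ∀ m → m ≤ n → A (suc m) ≡ B (suc m)
  A≡B m m≤n = +-cancelʳ-≡ _ _ _ (+-cancelˡ-≡ m _ _ (begin
    m + (A (suc m) + O (suc m))         ≡⟨ +-assoc m _ _ ⟨
    m + A (suc m) + O (suc m)           ≡⟨ cong (_+ O (suc m)) (E-closed m m≤n) ⟨
    E (suc m) + O (suc m)               ≡⟨ E+O m m≤n ⟩
    2 * m                               ≡⟨ cong (_+_ m) (trans (+-identityʳ m) (sym (O-closed m m≤n))) ⟩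
    m + (O (suc m) + B (suc m))         ≡⟨ cong (_+_ m) (+-comm (O (suc m)) _) ⟩
    m + (B (suc m) + O (suc m))         ∎))
    where open ≡-Reasoning

  E≡O+2A : ∀ m → m ≤ n → E (suc m) ≡ O (suc m) + 2 * A (suc m)
  E≡O+2A m m≤n = begin
    E (suc m)                              ≡⟨ E-closed m m≤n ⟩
    m + A (suc m)                          ≡⟨ cong (_+ A (suc m)) (sym (O-closed m m≤n)) ⟩
    O (suc m) + B (suc m) + A (suc m)      ≡⟨ cong (λ b → O (suc m) + b + A (suc m)) (sym (A≡B m m≤n)) ⟩
    O (suc m) + A (suc m) + A (suc m)      ≡⟨ +-assoc (O (suc m)) _ _ ⟩
    O (suc m) + (A (suc m) + A (suc m))    ≡⟨ cong (λ a → O (suc m) + (A (suc m) + a)) (+-identityʳ _) ⟨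
    O (suc m) + 2 * A (suc m)              ∎
    where open ≡-Reasoning

  h≡2A : ∀ m → m ≤ n → h n C (suc m) ≡ + (2 * A (suc m))
  h≡2A m m≤n = trans (cong (λ e → + e ℤ.- + O (suc m)) (E≡O+2A m m≤n)) (+-minus-+ (O (suc m)) _)

  E-step : ∀ j → E (suc j) ≡ E j + count (λ i → (C i ≡ᵇ j) ∧ (i ≤ᵇ n)) allRows
  E-step j = begin
    E (suc j)                                            ≡⟨ count-interval _ 1 (2 * n) ⟩
    sumRange (λ i → 𝟙 ((C i <ᵇ suc j) ∧ (i ≤ᵇ n))) 1 end ≡⟨ sumRange-cong _ _ 1 end split ⟩
    sumRange (λ i → before i + this i) 1 end             ≡⟨ sumRange-+ before this 1 end ⟩
    sumRange before 1 end + sumRange this 1 end          ≡⟨ cong₂ _+_ (count-interval _ 1 (2 * n)) (count-interval _ 1 (2 * n)) ⟨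
    E j + count (λ i → (C i ≡ᵇ j) ∧ (i ≤ᵇ n)) allRows    ∎
    where
    open ≡-Reasoning
    end : ℕ
    end = suc (2 * n)
    before this : ℕ → ℕ
    before i = 𝟙 ((C i <ᵇ j) ∧ (i ≤ᵇ n))
    this i   = 𝟙 ((C i ≡ᵇ j) ∧ (i ≤ᵇ n))
    split : Between 1 end (λ i → 𝟙 ((C i <ᵇ suc j) ∧ (i ≤ᵇ n)) ≡ before i + this i)
    split i _ _ = 𝟙-∧-+ (C i <ᵇ suc j) (C i <ᵇ j) (C i ≡ᵇ j) (i ≤ᵇ n) (𝟙-<ᵇ-suc (C i) j)

  A-step : ∀ {j} (c : Column j) → 1 ≤ j → j ≤ n → A (suc j) + 1 ≡ A j + (𝟙 (x c ≤ᵇ n) + 𝟙 (y c ≤ᵇ n))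
  A-step {suc m} c _ j≤n = +-cancelˡ-≡ m _ _ (begin
    m + (A (suc (suc m)) + 1)                       ≡⟨ cong (_+_ m) (+-comm _ 1) ⟩
    m + suc (A (suc (suc m)))                       ≡⟨ +-suc m _ ⟩
    suc m + A (suc (suc m))                         ≡⟨ E-closed (suc m) j≤n ⟨
    E (suc (suc m))                                 ≡⟨ E-step (suc m) ⟩
    E (suc m) + _                                   ≡⟨ cong₂ _+_ (E-closed m (<⇒≤ j≤n)) (even-dots c) ⟩
    m + A (suc m) + (𝟙 (x c ≤ᵇ n) + 𝟙 (y c ≤ᵇ n))   ≡⟨ +-assoc m _ _ ⟩
    m + (A (suc m) + (𝟙 (x c ≤ᵇ n) + 𝟙 (y c ≤ᵇ n))) ∎)
    where open ≡-Reasoning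

  A-even-even : ∀ {j} (c : Column j) → 1 ≤ j → j ≤ n → y c ≤ n → A (suc j) ≡ suc (A j)
  A-even-even c 1≤j j≤n y≤n with A-step c 1≤j j≤n
  ... | e rewrite ≤ᵇ-true (≤-trans (<⇒≤ (x<y c)) y≤n) | ≤ᵇ-true y≤n = +-cancelʳ-≡ 1 _ _ (trans e (+-suc _ 1))

  A-even-odd : ∀ {j} (c : Column j) → 1 ≤ j → j ≤ n → x c ≤ n → n < y c → A (suc j) ≡ A j
  A-even-odd c 1≤j j≤n x≤n n<y with A-step c 1≤j j≤n
  ... | e rewrite ≤ᵇ-true x≤n | ≤ᵇ-false n<y = +-cancelʳ-≡ 1 _ _ e

  A-odd-odd : ∀ {j} (c : Column j) → 1 ≤ j → j ≤ n → n < x c → A j ≡ suc (A (suc j))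
  A-odd-odd c 1≤j j≤n n<x with A-step c 1≤j j≤n
  ... | e rewrite ≤ᵇ-false n<x | ≤ᵇ-false (<-trans n<x (x<y c)) = trans (sym (trans e (+-identityʳ _))) (+-comm _ 1)

  le-sum : ∀ x → le n C x ≡ sumRange (λ i → 𝟙 (inv C x i)) (suc x) (suc n)
  le-sum x = count-interval _ (suc x) n

  ro-sum : ∀ y → 1 ≤ y → ro n C y ≡ sumRange (λ i → 𝟙 (inv C y i)) (suc n) y
  ro-sum (suc y) _ = count-interval _ (suc n) y

  module _ {j} (c : Column j) where

    inv-x : ∀ {i} → x c < i → 𝟙 (inv C (x c) i) ≡ 𝟙 (C i <ᵇ j)
    inv-x x<i = cong 𝟙 (trans (inv-above C x<i) (cong (C _ <ᵇ_) (Cx c)))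

    inv-y-after : ∀ {i} → y c < i → 𝟙 (inv C (y c) i) ≡ 𝟙 (C i <ᵇ j)
    inv-y-after y<i = cong 𝟙 (trans (inv-above C y<i) (cong (C _ <ᵇ_) (Cy c)))

    inv-y-before : ∀ {i} → i < y c → 𝟙 (inv C (y c) i) ≡ 𝟙 (j <ᵇ C i)
    inv-y-before i<y = cong 𝟙 (trans (inv-below C i<y) (cong (_<ᵇ C _) (Cy c)))

    inv-x-before : ∀ {i} → i < x c → 𝟙 (inv C (x c) i) ≡ 𝟙 (j <ᵇ C i)
    inv-x-before i<x = cong 𝟙 (trans (inv-below C i<x) (cong (_<ᵇ C _) (Cx c)))

    le-bound : x c ≤ n → le n C (x c) ≤ A j
    le-bound x≤n = subst (_≤ A j) (sym (le-sum (x c)))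
      (sumRange-sub _ _ (≤-trans (j≤x c) (n≤1+n _)) (s≤s x≤n) ≤-refl (λ i x<i _ → ≤-reflexive (inv-x x<i)))

    le-anti : y c ≤ n → le n C (y c) ≤ le n C (x c)
    le-anti y≤n = subst₂ _≤_ (sym (le-sum (y c))) (sym (le-sum (x c)))
      (sumRange-sub _ _ (s≤s (<⇒≤ (x<y c))) (s≤s y≤n) ≤-refl
        (λ i y<i _ → ≤-reflexive (trans (inv-y-after y<i) (sym (inv-x (<-trans (x<y c) y<i))))))

    ro-bound : n < y c → ro n C (y c) ≤ B j
    ro-bound n<y = subst (_≤ B j) (sym (ro-sum (y c) (1≤y c)))
      (sumRange-sub _ _ ≤-refl n<y (y≤n+j c)
        (λ i _ i<y → subst (_≤ 𝟙 (j ≤ᵇ C i)) (sym (inv-y-before i<y)) (𝟙-<ᵇ≤𝟙-≤ᵇ j (C i))))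

    ro-mono : n < x c → ro n C (x c) ≤ ro n C (y c)
    ro-mono n<x = subst₂ _≤_ (sym (ro-sum (x c) (1≤x c))) (sym (ro-sum (y c) (1≤y c)))
      (sumRange-sub _ _ ≤-refl n<x (<⇒≤ (x<y c))
        (λ i _ i<x → ≤-reflexive (trans (inv-x-before i<x) (sym (inv-y-before (<-trans i<x (x<y c)))))))

    -- When both dots are odd, the lower one is counted by B j but not inverted with the upper one.
    ro-bound-strict : n < x c → ro n C (y c) + 1 ≤ B j
    ro-bound-strict n<x = begin
      ro n C (y c) + 1                                           ≡⟨ cong (_+ 1) (ro-sum (y c) (1≤y c)) ⟩
      sumRange r (suc n) (y c) + 1                               ≡⟨ cong (_+ 1) (sumRange-split r n<x (<⇒≤ (x<y c))) ⟩
      sumRange r (suc n) (x c) + sumRange r (x c) (y c) + 1      ≡⟨ cong (λ s → sumRange r (suc n) (x c) + s + 1) (sumRange-first r (x<y c)) ⟩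
      sumRange r (suc n) (x c) + (r (x c) + sumRange r (suc (x c)) (y c)) + 1
                                                                 ≡⟨ cong (λ t → sumRange r (suc n) (x c) + (t + sumRange r (suc (x c)) (y c)) + 1) r-x ⟩
      sumRange r (suc n) (x c) + sumRange r (suc (x c)) (y c) + 1 ≡⟨ +-assoc (sumRange r (suc n) (x c)) _ 1 ⟩
      sumRange r (suc n) (x c) + (sumRange r (suc (x c)) (y c) + 1) ≡⟨ cong (_+_ (sumRange r (suc n) (x c))) (+-comm _ 1) ⟩
      sumRange r (suc n) (x c) + (1 + sumRange r (suc (x c)) (y c))
        ≤⟨ +-mono-≤ (sumRange-mono r G (suc n) (x c) (λ i _ i<x → r≤G (<-trans i<x (x<y c))))
                    (s≤s (sumRange-sub r G ≤-refl (x<y c) (y≤n+j c) (λ i _ i<y → r≤G i<y))) ⟩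
      sumRange G (suc n) (x c) + (1 + sumRange G (suc (x c)) (n + j)) ≡⟨ cong (λ t → sumRange G (suc n) (x c) + (t + sumRange G (suc (x c)) (n + j))) G-x ⟨
      sumRange G (suc n) (x c) + (G (x c) + sumRange G (suc (x c)) (n + j)) ≡⟨ cong (_+_ (sumRange G (suc n) (x c))) (sumRange-first G x<n+j) ⟨
      sumRange G (suc n) (x c) + sumRange G (x c) (n + j)        ≡⟨ sumRange-split G n<x (<⇒≤ x<n+j) ⟨
      B j                                                        ∎
      where
      open ≤-Reasoning
      r G : ℕ → ℕ
      r i = 𝟙 (inv C (y c) i)
      G i = 𝟙 (j ≤ᵇ C i)
      x<n+j : x c < n + j
      x<n+j = <-≤-trans (x<y c) (y≤n+j c)
      r≤G : ∀ {i} → i < y c → r i ≤ G i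
      r≤G i<y = subst (_≤ G _) (sym (inv-y-before i<y)) (𝟙-<ᵇ≤𝟙-≤ᵇ j (C _))
      r-x : r (x c) ≡ 0
      r-x = trans (inv-y-before (x<y c)) (cong 𝟙 (trans (cong (j <ᵇ_) (Cx c)) (<ᵇ-false (≤-refl {j}))))
      G-x : G (x c) ≡ 1
      G-x = cong 𝟙 (trans (cong (j ≤ᵇ_) (Cx c)) (≤ᵇ-true (≤-refl {j})))

  A-start : A 1 ≡ 0
  A-start = sumRange-zero _ 1 (suc n)
    (λ i 1≤i i≤n → cong 𝟙 (<ᵇ-false (column-pos 1≤i (≤-trans (≤-pred i≤n) n≤2n))))

  A-end : A (suc n) ≡ 0
  A-end = sumRange-empty _ (suc n)

  ReachedBy : ℕ → ℕ → Set
  ReachedBy m K = ∃ λ c → (1 ≤ c) × (c ≤ m) × (i₂ n C c ≤ n) × (A (suc c) ≡ K)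

  reached-later : ∀ {m K} → ReachedBy m K → ReachedBy (suc m) K
  reached-later (c , 1≤c , c≤m , even , A≡K) = c , 1≤c , m≤n⇒m≤1+n c≤m , even , A≡K

  -- The half-height only rises, by one, at even-even columns: every value 1 ≤ K ≤ A (m+1)
  -- is reached right after some even-even column c ≤ m.
  reached : ∀ m → m ≤ n → ∀ K → 1 ≤ K → K ≤ A (suc m) → ReachedBy m K
  reached zero    _   K 1≤K K≤A = ⊥-elim (<⇒≱ 1≤K (subst (K ≤_) A-start K≤A))
  reached (suc m) m<n K 1≤K K≤A = by-kind (kind c)
    where
    c : Column (suc m)
    c = column (suc m) (s≤s z≤n) m<n
    before : K ≤ A (suc m) → ReachedBy (suc m) K
    before K≤A' = reached-later (reached m (<⇒≤ m<n) K 1≤K K≤A')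
    by-kind : Kind c → ReachedBy (suc m) K
    by-kind (even-even y≤n) with K ≟ A (suc (suc m))
    ... | yes refl = suc m , s≤s z≤n , ≤-refl , subst (_≤ n) (sym (i₂≡y c)) y≤n , refl
    ... | no  K≢A  = before (≤-pred (subst (K <_) (A-even-even c (s≤s z≤n) m<n y≤n) (≤∧≢⇒< K≤A K≢A)))
    by-kind (even-odd x≤n n<y) = before (subst (K ≤_) (A-even-odd c (s≤s z≤n) m<n x≤n n<y) K≤A)
    by-kind (odd-odd n<x)      = before (≤-trans (m≤n⇒m≤1+n K≤A) (≤-reflexive (sym (A-odd-odd c (s≤s z≤n) m<n n<x))))

  -- For an odd-odd column m+1, the paper's column j_m exists: it is the last even-even
  -- column j' ≤ m after which the half-height equals the current one, A (m+1).
  jm-spec : ∀ m → suc m ≤ n → (c : Column (suc m)) → n < x c →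
            let j' = jm n C (suc m) in (1 ≤ j') × (j' ≤ m) × (i₂ n C j' ≤ n) × (A (suc j') ≡ A (suc m))
  jm-spec m m<n c n<x = proj₁ bounds , proj₂ bounds , ≤ᵇ⇒≤ _ n (proj₂ chosen) , same-height
    where
    m≤n : m ≤ n
    m≤n = <⇒≤ m<n
    j' : ℕ
    j' = jm n C (suc m)
    candidate : ℕ → Bool
    candidate i = ⌊ h n C (suc i) ℤ.≟ h n C (suc m) ⌋ ∧ (i₂ n C i ≤ᵇ n)
    candidate? : ∀ i → Dec (T (candidate i))
    candidate? i = T? (candidate i)
    -- The current half-height is positive, since the upper odd dot has an inversion less than B.
    1≤A : 1 ≤ A (suc m)
    1≤A = subst (1 ≤_) (sym (A≡B m m≤n)) (≤-trans (m≤n+m 1 _) (ro-bound-strict c n<x))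
    candidate-from : ReachedBy m (A (suc m)) → ∃ λ c' → c' ∈ filterᵇ candidate (interval 1 m)
    candidate-from (c' , 1≤c' , c'≤m , even , A≡) = c' , ∈-filter⁺ candidate? (∈-interval⁺ 1≤c' c'≤m) (Equivalence.from T-∧
      ( fromWitness (trans (h≡2A c' (≤-trans c'≤m m≤n)) (trans (cong (λ a → + (2 * a)) A≡) (sym (h≡2A m m≤n))))
      , ≤⇒≤ᵇ even))
    -- j_m is the last candidate, so it is a candidate itself.
    j'-candidate : j' ∈ interval 1 m × T (candidate j')
    j'-candidate = ∈-filter⁻ candidate? (lastD-∈ _ (proj₂ (candidate-from (reached m m≤n (A (suc m)) 1≤A ≤-refl))))
    bounds : (1 ≤ j') × (j' ≤ m)
    bounds = ∈-interval⁻ (proj₁ j'-candidate)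
    chosen : T ⌊ h n C (suc j') ℤ.≟ h n C (suc m) ⌋ × T (i₂ n C j' ≤ᵇ n)
    chosen = Equivalence.to T-∧ (proj₂ j'-candidate)
    same-height : A (suc j') ≡ A (suc m)
    same-height = +2*-injective (trans (sym (h≡2A j' (≤-trans (proj₂ bounds) m≤n))) (trans (toWitness (proj₁ chosen)) (h≡2A m m≤n)))

  even-even-entry : ∀ {j} → 1 ≤ j → j ≤ n → i₂ n C j ≤ n →
                    (le n C (i₁ n C j) + 1 ≤ A (suc j)) × (le n C (i₂ n C j) ≤ le n C (i₁ n C j))
  even-even-entry {j} 1≤j j≤n i₂≤n = subst₂ Entry (sym (i₁≡x c)) (sym (i₂≡y c))
    ( ≤-trans (+-monoˡ-≤ 1 (le-bound c x≤n)) (≤-reflexive (trans (+-comm _ 1) (sym (A-even-even c 1≤j j≤n y≤n))))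
    , le-anti c y≤n)
    where
    c : Column j
    c = column j 1≤j j≤n
    y≤n : y c ≤ n
    y≤n = subst (_≤ n) (i₂≡y c) i₂≤n
    x≤n : x c ≤ n
    x≤n = ≤-trans (<⇒≤ (x<y c)) y≤n
    Entry : ℕ → ℕ → Set
    Entry u v = (le n C u + 1 ≤ A (suc j)) × (le n C v ≤ le n C u)

  odd-odd-entry : ∀ m → suc m ≤ n → (c : Column (suc m)) → n < x c →
                  let j' = jm n C (suc m) in
                  (le n C (i₁ n C j') + 1 ≤ A (suc m)) × (le n C (i₂ n C j') ≤ le n C (i₁ n C j'))
  odd-odd-entry m m<n c n<x = subst (λ a → le n C (i₁ n C j') + 1 ≤ a) same-height (proj₁ entry) , proj₂ entry
    where
    j' : ℕ
    j' = jm n C (suc m)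
    spec : (1 ≤ j') × (j' ≤ m) × (i₂ n C j' ≤ n) × (A (suc j') ≡ A (suc m))
    spec = jm-spec m m<n c n<x
    same-height : A (suc j') ≡ A (suc m)
    same-height = proj₂ (proj₂ (proj₂ spec))
    entry : (le n C (i₁ n C j') + 1 ≤ A (suc j')) × (le n C (i₂ n C j') ≤ le n C (i₁ n C j'))
    entry = even-even-entry (proj₁ spec) (≤-trans (proj₁ (proj₂ spec)) (<⇒≤ m<n)) (proj₁ (proj₂ (proj₂ spec)))

  even-odd-contribution : ℕ → ℕ → List Step × List (ℕ × ℕ)
  even-odd-contribution u v =
    (if ro n C v <ᵇ le n C u then D ∷ U ∷ [] else U ∷ D ∷ []) , (le n C u , ro n C v) ∷ []

  odd-odd-contribution : ℕ → ℕ → ℕ → List Step × List (ℕ × ℕ)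
  odd-odd-contribution j u v =
    D ∷ D ∷ [] , (le n C (i₁ n C (jm n C j)) , le n C (i₂ n C (jm n C j))) ∷ (ro n C u , ro n C v) ∷ []

  contribution : ℕ → ℕ → ℕ → List Step × List (ℕ × ℕ)
  contribution j u v = if v ≤ᵇ n then (U ∷ U ∷ [] , [])
                       else if u ≤ᵇ n then even-odd-contribution u v
                       else odd-odd-contribution j u v

  colStep-contribution : ∀ {j} (c : Column j) → colStep n C j ≡ contribution j (x c) (y c)
  colStep-contribution {j} c = cong₂ (contribution j) (i₁≡x c) (i₂≡y c)

  contribution-even-even : ∀ {j u v} → v ≤ n → contribution j u v ≡ (U ∷ U ∷ [] , [])
  contribution-even-even {j} {u} {v} v≤n =
    cong (λ b → if b then (U ∷ U ∷ [] , []) else if u ≤ᵇ n then even-odd-contribution u v else odd-odd-contribution j u v)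
         (≤ᵇ-true v≤n)

  contribution-even-odd : ∀ {j u v} → u ≤ n → n < v → contribution j u v ≡ even-odd-contribution u v
  contribution-even-odd {j} {u} {v} u≤n n<v =
    cong₂ (λ b b' → if b then (U ∷ U ∷ [] , []) else if b' then even-odd-contribution u v else odd-odd-contribution j u v)
          (≤ᵇ-false n<v) (≤ᵇ-true u≤n)

  contribution-odd-odd : ∀ {j u v} → n < u → n < v → contribution j u v ≡ odd-odd-contribution j u v
  contribution-odd-odd {j} {u} {v} n<u n<v =
    cong₂ (λ b b' → if b then (U ∷ U ∷ [] , []) else if b' then even-odd-contribution u v else odd-odd-contribution j u v)
          (≤ᵇ-false n<v) (≤ᵇ-false n<u)

  column-transition : ∀ j → 1 ≤ j → j ≤ n → Transition (A j) (proj₁ (colStep n C j)) (proj₂ (colStep n C j))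
  column-transition (suc m) 1≤j j≤n = by-kind (kind c)
    where
    c : Column (suc m)
    c = column (suc m) 1≤j j≤n
    Admissible : List Step × List (ℕ × ℕ) → Set
    Admissible p = Transition (A (suc m)) (proj₁ p) (proj₂ p)
    balance : A (suc m) ≡ B (suc m)
    balance = A≡B m (<⇒≤ j≤n)
    mixed : x c ≤ n → n < y c → ∀ b → (ro n C (y c) <ᵇ le n C (x c)) ≡ b →
               Admissible ((if b then D ∷ U ∷ [] else U ∷ D ∷ []) , (le n C (x c) , ro n C (y c)) ∷ [])
    mixed x≤n n<y true  order = down-up (le-bound c x≤n) (reflects-holds (<ᵇ-reflects-< (ro n C (y c)) (le n C (x c))) order)
    mixed x≤n n<y false order = up-down (≮⇒≥ (reflects-fails (<ᵇ-reflects-< (ro n C (y c)) (le n C (x c))) order))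
                                           (subst (ro n C (y c) ≤_) (sym balance) (ro-bound c n<y))
    by-kind : Kind c → Admissible (colStep n C (suc m))
    by-kind (even-even y≤n) = subst Admissible (sym (trans (colStep-contribution c) (contribution-even-even {suc m} y≤n))) up-up
    by-kind (even-odd x≤n n<y) = subst Admissible (sym (trans (colStep-contribution c) (contribution-even-odd {suc m} x≤n n<y)))
      (mixed x≤n n<y (ro n C (y c) <ᵇ le n C (x c)) refl)
    by-kind (odd-odd n<x) = subst Admissible (sym (trans (colStep-contribution c) (contribution-odd-odd {suc m} n<x (<-trans n<x (x<y c)))))
      (down-down (proj₁ (odd-odd-entry m j≤n c n<x)) (proj₂ (odd-odd-entry m j≤n c n<x)) (ro-mono c n<x)
                 (subst (ro n C (y c) + 1 ≤_) (sym balance) (ro-bound-strict c n<x)))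

  column-height : ∀ j → 1 ≤ j → j ≤ n → + (2 * A j) ℤ.+ ht (proj₁ (colStep n C j)) ≡ + (2 * A (suc j))
  column-height j 1≤j j≤n = by-kind (kind c)
    where
    c : Column j
    c = column j 1≤j j≤n
    Moves : List Step × List (ℕ × ℕ) → Set
    Moves p = + (2 * A j) ℤ.+ ht (proj₁ p) ≡ + (2 * A (suc j))
    by-kind : Kind c → Moves (colStep n C j)
    by-kind (even-even y≤n) = subst Moves (sym (trans (colStep-contribution c) (contribution-even-even {j} y≤n)))
      (trans (up-up-height (A j)) (cong (λ a → + (2 * a)) (sym (A-even-even c 1≤j j≤n y≤n))))
    by-kind (even-odd x≤n n<y) = subst Moves (sym (trans (colStep-contribution c) (contribution-even-odd {j} x≤n n<y)))
      (trans (mixed-height (A j) (ro n C (y c) <ᵇ le n C (x c))) (cong (λ a → + (2 * a)) (sym (A-even-odd c 1≤j j≤n x≤n n<y))))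
    by-kind (odd-odd n<x) = subst Moves (sym (trans (colStep-contribution c) (contribution-odd-odd {j} n<x (<-trans n<x (x<y c)))))
      (trans (cong (λ a → + (2 * a) ℤ.+ ht (D ∷ D ∷ [])) (A-odd-odd c 1≤j j≤n n<x)) (down-down-height (A (suc j))))

proposition9 : ∀ (n : ℕ) → 1 ≤ n → ∀ (C : ℕ → ℕ) → DC n C → DH n (Φ n C)
proposition9 n _ C dc =
  ColumnSequence.dellac-history n (λ j → proj₁ (colStep n C j)) (λ j → proj₂ (colStep n C j)) A
    column-transition column-height A-start A-end
  where open Configuration n C dc
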